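{- Let $q$ be an odd prime and let $r\ge 2$. (a) The number of block-columns in the parity-check matrix of a shortened array code with modulus $q$, column weight $r$ and girth eight is at most $1+(q-1)/(r-1)$. (b) The number of block-columns in the parity-check matrix of a shortened array code with modulus $q$, column weight $r$ and girth ten is at most $$\frac{q+r(2r-3)+\sqrt{(q+r(2r-3))^2-4r(r-1)^3}}{2r(r-1)}.$$
   Context: For integers $a\le b$, $[a,b]=\{x\in\mathbb{Z}: a\le x\le b\}$. Let $q$ be an odd prime, $I$ the $q\times q$ identity matrix and $P\ne I$ a $q\times q$ circulant permutation matrix. Given $r\in[1,q]$ and distinct integers $a_0,\dots,a_{r-1}\in[0,q-1]$, the array code with modulus $q$ has parity-check matrix $H$ formed by an $r\times q$ array of $q\times q$ blocks, the block in block-row $i\in[0,r-1]$ and block-column $j\in[0,q-1]$ being $P^{a_i\cdot j}$; its column weight is $r$. A shortened array code is the code whose parity-check matrix is obtained from $H$ by deleting a set of block-columns. The girth of a code is the length of a shortest cycle in its Tanner graph (the bipartite graph with a vertex for each column and each row of the parity-check matrix, column and row vertices adjacent iff the corresponding entry is $1$). -}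

module Defs where

open import Data.Nat using (ℕ; zero; suc; _+_; _*_; _%_; _<_; _≤_; NonZero)
open import Data.Fin using (Fin; toℕ)
open import Data.Fin.Subset using (Subset; _∈_)
open import Data.Integer as ℤ using (ℤ; +_)
open import Data.Product using (Σ; _×_; _,_)
open import Data.Sum using (_⊎_; inj₁; inj₂)
open import Data.Empty using (⊥)
open import Function.Definitions using (Injective)
open import Relation.Binary.PropositionalEquality using (_≡_)
open import Relation.Nullary using (¬_)

-- Parameters of a shortened array code with modulus q:
--   s   : the shift of the circulant permutation matrix P (P ≠ I iff s ≢ 0 mod q);
--         entry (y , x) of P^k is 1 iff x ≡ y + k·s (mod q).
--   a   : the distinct exponents a_0 … a_{r-1} ∈ [0, q-1].
--   S   : the set of block-columns that are kept (the others are deleted).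
-- Column vertices of the Tanner graph: (j , x) with j ∈ S (block column j, column x in it).
-- Row vertices: (i , y) (block row i, row y in it).

Vertex : ℕ → ℕ → Set
Vertex q r = (Fin q × Fin q) ⊎ (Fin r × Fin q)

-- entry (y , x) of the block P^(a_i · j) is 1
Entry : (q : ℕ) .{{_ : NonZero q}} → ℕ → {r : ℕ} → (Fin r → Fin q) →
        Fin r → Fin q → Fin q → Fin q → Set
Entry q s a i j y x = (toℕ y + toℕ (a i) * toℕ j * s) % q ≡ toℕ x

Adj : (q : ℕ) .{{_ : NonZero q}} → ℕ → {r : ℕ} → (Fin r → Fin q) → Subset q →
      Vertex q r → Vertex q r → Set
Adj q s a S (inj₁ (j , x)) (inj₂ (i , y)) = j ∈ S × Entry q s a i j y x
Adj q s a S (inj₂ (i , y)) (inj₁ (j , x)) = j ∈ S × Entry q s a i j y x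
Adj q s a S (inj₁ _) (inj₁ _) = ⊥
Adj q s a S (inj₂ _) (inj₂ _) = ⊥

CycSucc : (k : ℕ) → Fin k → Fin k → Set
CycSucc k i j = toℕ j ≡ suc (toℕ i) ⊎ (toℕ j ≡ 0 × suc (toℕ i) ≡ k)

HasCycle : {V : Set} → (V → V → Set) → ℕ → Set
HasCycle {V} E k =
  3 ≤ k × Σ (Fin k → V) (λ w →
    Injective _≡_ _≡_ w × (∀ i j → CycSucc k i j → E (w i) (w j)))

HasGirth : {V : Set} → (V → V → Set) → ℕ → Set
HasGirth E g = HasCycle E g × (∀ k → k < g → ¬ HasCycle E k)

-- n ≤ (A + √D) / B  (real square root; B > 0), stated without reals:
-- √D must exist (0 ≤ D) and B·n − A ≤ √D, i.e. B·n − A ≤ 0 or (B·n − A)² ≤ D.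
LeRootBound : ℕ → ℤ → ℤ → ℤ → Set
LeRootBound n A D B =
  (+ 0) ℤ.≤ D × (B ℤ.* (+ n) ℤ.- A ℤ.≤ (+ 0)
                ⊎ (B ℤ.* (+ n) ℤ.- A) ℤ.* (B ℤ.* (+ n) ℤ.- A) ℤ.≤ D)

module Submission where

-- Write a column vertex of the Tanner graph as (block column j, x) and a row vertex as
-- (block row i, y); they are adjacent iff x ≡ y + a_i·j·s (mod q). Going from block column j
-- through block row i to block column j′ therefore shifts the position x by s·a_i·(j′ − j), and a
-- closed walk through block columns j₀, …, j_{k−1} and block rows i₁, …, i_k closes up iff
-- Σ s·a_{i_t}·(j_t − j_{t−1}) ≡ 0 (mod q). For a 4-walk this sum is s·(a_i − a_i′)·(j − j′), which
-- q cannot divide because q is prime: there are no 4-cycles, and every degenerate closed 6- or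
-- 8-walk reduces to this case. Fix a kept block column j₀ and let n = |S|.
-- (a) Without 6-cycles the residues of s·(a_t − a_0)·(j − j₀) for t ≠ 0, j ≠ j₀, together with 0,
--     are pairwise distinct, so 1 + (r − 1)(n − 1) ≤ q.
-- (b) Without 6- and 8-cycles the non-backtracking walks of length 0, 2 and 4 from the column
--     vertex (j₀, 0) end at pairwise distinct column vertices, so
--     1 + r(n − 1) + r(r − 1)(n − 1)² ≤ nq; this quadratic inequality in n says that n lies below
--     its larger root.

open import Defs
open import Data.Bool using (true; false)
open import Data.Empty using (⊥-elim)
open import Data.Fin as Fin using (Fin; toℕ; fromℕ; fromℕ<)
import Data.Fin.Properties as Fin
import Data.Fin.Subset as Subset
open Subset using (Subset; _∈_)
import Data.Integer as ℤ
import Data.Integer.DivMod as ℤ÷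
import Data.Integer.Divisibility.Signed as ℤ∣
import Data.Integer.Properties as ℤₚ
open import Data.Integer.Tactic.RingSolver using (solve-∀)
open import Data.Nat as ℕ using (ℕ; zero; suc; NonZero; z≤n; s≤s)
import Data.Nat.DivMod as ℕ÷
import Data.Nat.Divisibility as ℕ∣
open import Data.Nat.Primality using (Prime; euclidsLemma)
import Data.Nat.Properties as ℕₚ
open import Data.Product using (_×_; _,_; proj₂)
open import Data.Product.Function.NonDependent.Propositional using (_×-↔_)
open import Data.Product.Properties using (,-injectiveˡ; ,-injectiveʳ)
open import Data.Sum using (_⊎_; inj₁; inj₂)
open import Data.Sum.Function.Propositional using (_⊎-↔_)
import Data.Sum.Properties as Sum
open import Data.Unit using (⊤)
open import Data.Vec using (Vec; []; _∷_; lookup; head; last; map; _⋎_; here; there)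
open import Data.Vec.Relation.Unary.All as All using (All; []; _∷_)
open import Data.Vec.Relation.Unary.AllPairs using ([]; _∷_)
open import Data.Vec.Relation.Unary.Linked using (Linked; []; [-]; _∷_)
open import Data.Vec.Relation.Unary.Unique.Propositional using (Unique)
open import Data.Vec.Relation.Unary.Unique.Propositional.Properties using (lookup-injective)
open import Function using (_∘_)
open import Function.Bundles using (_↔_; _↣_; Injection; mk↣)
open import Function.Construct.Composition using (_↣-∘_; _↔-∘_)
open import Function.Definitions using (Injective)
open import Function.Properties.Inverse using (↔⇒↣; ↔-sym; ↔-refl)
open import Relation.Binary.PropositionalEquality
  using (_≡_; _≢_; refl; sym; trans; cong; cong₂; subst; subst₂; module ≡-Reasoning)
open import Relation.Nullary using (¬_; contradiction; yes; no)
open import Relation.Nullary.Decidable using (True; toWitness)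

module Congruence (q : ℕ) (q-prime : Prime q) .{{_ : NonZero q}} where
  open ℤ using (ℤ; +_; 0ℤ; _+_; _*_; _-_; -_)
  open ℤ∣ using (_∣_; divides; ∣ᵤ⇒∣; ∣⇒∣ᵤ; ∣m∣n⇒∣m+n; ∣m∣n⇒∣m-n)

  ∤-* : ∀ {u v} → ¬ + q ∣ u → ¬ + q ∣ v → ¬ + q ∣ u * v
  ∤-* {u} {v} q∤u q∤v q∣uv
    with euclidsLemma ℤ.∣ u ∣ ℤ.∣ v ∣ q-prime (subst (q ℕ∣.∣_) (ℤₚ.abs-* u v) (∣⇒∣ᵤ q∣uv))
  ... | inj₁ q∣u = q∤u (∣ᵤ⇒∣ q∣u)
  ... | inj₂ q∣v = q∤v (∣ᵤ⇒∣ q∣v)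

  q∣i∧∣i∣<q⇒i≡0 : ∀ {i} → + q ∣ i → ℤ.∣ i ∣ ℕ.< q → i ≡ 0ℤ
  q∣i∧∣i∣<q⇒i≡0 {i} q∣i ∣i∣<q with ℤ.∣ i ∣ in eq
  ... | zero  = ℤₚ.∣i∣≡0⇒i≡0 eq
  ... | suc _ = contradiction (subst (q ℕ∣.∣_) eq (∣⇒∣ᵤ q∣i)) (ℕ∣.>⇒∤ ∣i∣<q)

  ∣+m-+n⇒m≡n : ∀ {m n} → m ℕ.< q → n ℕ.< q → + q ∣ + m - + n → m ≡ n
  ∣+m-+n⇒m≡n {m} {n} m<q n<q q∣m-n =
    ℤₚ.+-injective (ℤₚ.i-j≡0⇒i≡j (+ m) (+ n) (q∣i∧∣i∣<q⇒i≡0 q∣m-n ∣m-n∣<q))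
    where
    ∣m-n∣<q : ℤ.∣ + m - + n ∣ ℕ.< q
    ∣m-n∣<q = subst (ℕ._< q) (cong ℤ.∣_∣ (sym (ℤₚ.m-n≡m⊖n m n)))
                (ℕₚ.≤-<-trans (ℤₚ.∣m⊝n∣≤m⊔n m n) (ℕₚ.⊔-lub m<q n<q))

  ∣%ℕ- : ∀ u → + q ∣ + (u ℤ.%ℕ q) - u
  ∣%ℕ- u = divides (- (u ℤ./ℕ q)) (begin
    + (u ℤ.%ℕ q) - u                                   ≡⟨ cong (λ v → + (u ℤ.%ℕ q) - v) (ℤ÷.a≡a%ℕn+[a/ℕn]*n u q) ⟩
    + (u ℤ.%ℕ q) - (+ (u ℤ.%ℕ q) + (u ℤ./ℕ q) * + q)   ≡⟨ cancel (+ (u ℤ.%ℕ q)) (u ℤ./ℕ q) (+ q) ⟩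
    - (u ℤ./ℕ q) * + q                                 ∎)
    where
    open ≡-Reasoning
    cancel : ∀ x k q → x - (x + k * q) ≡ - k * q
    cancel = solve-∀

  -- Opaque, so that unification never tries to invert it.
  opaque
    residue : ℤ → Fin q
    residue u = fromℕ< (ℤ÷.n%ℕd<d u q)

    ∣residue- : ∀ u → + q ∣ + toℕ (residue u) - u
    ∣residue- u = subst (λ x → + q ∣ + x - u) (sym (Fin.toℕ-fromℕ< _)) (∣%ℕ- u)

  residue≡⇒∣ : ∀ {u v} → residue u ≡ residue v → + q ∣ u - v
  residue≡⇒∣ {u} {v} eq = subst (+ q ∣_) (difference (+ toℕ (residue v)) u v)
    (∣m∣n⇒∣m-n (∣residue- v) (subst (λ x → + q ∣ + toℕ x - u) eq (∣residue- u)))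
    where
    difference : ∀ x u v → (x - v) - (x - u) ≡ u - v
    difference = solve-∀

  residue≡residue0⇒∣ : ∀ {u} → residue u ≡ residue 0ℤ → + q ∣ u
  residue≡residue0⇒∣ {u} eq = subst (+ q ∣_) (ℤₚ.+-identityʳ u) (residue≡⇒∣ eq)

  ∣⇒%≡residue : ∀ n u → + q ∣ + n - u → n ℕ.% q ≡ toℕ (residue u)
  ∣⇒%≡residue n u q∣n-u = ∣+m-+n⇒m≡n (ℕ÷.m%n<n n q) (Fin.toℕ<n (residue u))
    (subst (+ q ∣_) (difference (+ (n ℕ.% q)) (+ n) u (+ toℕ (residue u)))
      (∣m∣n⇒∣m-n (∣m∣n⇒∣m+n (∣%ℕ- (+ n)) q∣n-u) (∣residue- u)))
    where
    difference : ∀ x y z w → ((x - y) + (y - z)) - (w - z) ≡ x - w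
    difference = solve-∀

module _ {V : Set} {E : V → V → Set} where

  Linked-lookup : ∀ {n} {vs : Vec V n} → Linked E vs →
                  ∀ {i j} → toℕ j ≡ suc (toℕ i) → E (lookup vs i) (lookup vs j)
  Linked-lookup {vs = _ ∷ _ ∷ _} (e ∷ _) {Fin.zero} {Fin.suc Fin.zero} _ = e
  Linked-lookup (_ ∷ es) {Fin.suc i} {Fin.suc j} j≡1+i = Linked-lookup es (ℕₚ.suc-injective j≡1+i)

  lookup-fromℕ : ∀ {n} (vs : Vec V (suc n)) → lookup vs (fromℕ n) ≡ last vs
  lookup-fromℕ (v ∷ [])     = refl
  lookup-fromℕ (v ∷ w ∷ vs) = lookup-fromℕ (w ∷ vs)

  closedWalk⇒cycle : ∀ {n} (vs : Vec V (3 ℕ.+ n)) →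
                     Unique vs → Linked E vs → E (last vs) (head vs) → HasCycle E (3 ℕ.+ n)
  closedWalk⇒cycle {n} vs@(_ ∷ _) unique linked closing =
    s≤s (s≤s (s≤s z≤n)) , lookup vs , lookup-injective unique _ _ , adjacent
    where
    adjacent : ∀ i j → CycSucc (3 ℕ.+ n) i j → E (lookup vs i) (lookup vs j)
    adjacent i j (inj₁ j≡1+i)         = Linked-lookup linked j≡1+i
    adjacent i j (inj₂ (j≡0 , 1+i≡k)) = subst₂ E (sym i-last) (cong (lookup vs) (sym j≡zero)) closing
      where
      i-last : lookup vs i ≡ last vs
      i-last = trans (cong (lookup vs) (Fin.toℕ-injective (trans (ℕₚ.suc-injective 1+i≡k) (sym (Fin.toℕ-fromℕ (2 ℕ.+ n))))))
                     (lookup-fromℕ vs)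
      j≡zero : j ≡ Fin.zero
      j≡zero = Fin.toℕ-injective j≡0

  shorter-cycles : ∀ {g} → HasGirth E g → ∀ k {k<g : True (k ℕ.<? g)} → ¬ HasCycle E k
  shorter-cycles girth k {k<g} = proj₂ girth k (toWitness k<g)

module _ {A B : Set} where

  All-interleave : ∀ {n} {P : A ⊎ B → Set} {as : Vec A n} {bs : Vec B n} →
                   All (P ∘ inj₁) as → All (P ∘ inj₂) bs → All P (map inj₁ as ⋎ map inj₂ bs)
  All-interleave []         []         = []
  All-interleave (pa ∷ pas) (pb ∷ pbs) = pa ∷ pb ∷ All-interleave pas pbs

  Unique-interleave : ∀ {n} {as : Vec A n} {bs : Vec B n} →
                      Unique as → Unique bs → Unique (map inj₁ as ⋎ map inj₂ bs)
  Unique-interleave []                 []                 = []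
  Unique-interleave (a∉as ∷ as-unique) (b∉bs ∷ bs-unique) =
    ((λ ()) ∷ All-interleave (All.map (λ a≢a′ → a≢a′ ∘ Sum.inj₁-injective) a∉as) (All.universal (λ _ ()) _))
    ∷ All-interleave (All.universal (λ _ ()) _) (All.map (λ b≢b′ → b≢b′ ∘ Sum.inj₂-injective) b∉bs)
    ∷ Unique-interleave as-unique bs-unique

enumerate : ∀ {n} (p : Subset n) → Fin Subset.∣ p ∣ → Fin n
enumerate (true  ∷ p) Fin.zero    = Fin.zero
enumerate (true  ∷ p) (Fin.suc k) = Fin.suc (enumerate p k)
enumerate (false ∷ p) k           = Fin.suc (enumerate p k)

enumerate-∈ : ∀ {n} (p : Subset n) k → enumerate p k ∈ p
enumerate-∈ (true  ∷ p) Fin.zero    = here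
enumerate-∈ (true  ∷ p) (Fin.suc k) = there (enumerate-∈ p k)
enumerate-∈ (false ∷ p) k           = there (enumerate-∈ p k)

enumerate-injective : ∀ {n} (p : Subset n) → Injective _≡_ _≡_ (enumerate p)
enumerate-injective (true  ∷ p) {Fin.zero}  {Fin.zero}  _  = refl
enumerate-injective (true  ∷ p) {Fin.suc k} {Fin.suc l} eq = cong Fin.suc (enumerate-injective p (Fin.suc-injective eq))
enumerate-injective (false ∷ p)                         eq = enumerate-injective p (Fin.suc-injective eq)

↣⇒≤ : ∀ {A B : Set} {m n} → Fin m ↔ A → B ↔ Fin n → A ↣ B → m ℕ.≤ n
↣⇒≤ Fm↔A B↔Fn A↣B = Fin.injective⇒≤ (Injection.injective ((↔⇒↣ B↔Fn ↣-∘ A↣B) ↣-∘ ↔⇒↣ Fm↔A))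

module TannerGraph (q : ℕ) (q-prime : Prime q) .{{_ : NonZero q}}
                   (s : ℕ) (s≢0 : s ℕ.% q ≢ 0)
                   {r : ℕ} (a : Fin r → Fin q) (a-injective : Injective _≡_ _≡_ a)
                   (S : Subset q) where
  open ℤ using (ℤ; +_; 0ℤ; _+_; _*_; _-_; -_)
  open ℤ∣ using (_∣_; divides; ∣⇒∣ᵤ; ∣m∣n⇒∣m+n; ∣m⇒∣-m)
  open Congruence q q-prime

  G : Vertex q r → Vertex q r → Set
  G = Adj q s a S

  A : Fin r → ℤ
  A i = + toℕ (a i)

  J : Fin q → ℤ
  J j = + toℕ j

  σ : ℤ
  σ = + s

  shift : Fin r → Fin q → ℤ
  shift i j = A i * J j * σ

  col : Fin q → ℤ → Vertex q r
  col j X = inj₁ (j , residue X)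

  row : Fin r → ℤ → Vertex q r
  row i Y = inj₂ (i , residue Y)

  edge : ∀ {j X Y} i → j ∈ S → + q ∣ (Y + shift i j) - X → G (col j X) (row i Y)
  edge {j} {X} {Y} i j∈S q∣Y+shift-X = j∈S , ∣⇒%≡residue _ X (subst (λ n → + q ∣ n - X) (sym cast)
    (subst (+ q ∣_) (regroup (+ toℕ (residue Y)) Y (shift i j) X) (∣m∣n⇒∣m+n (∣residue- Y) q∣Y+shift-X)))
    where
    cast : + (toℕ (residue Y) ℕ.+ toℕ (a i) ℕ.* toℕ j ℕ.* s) ≡ + toℕ (residue Y) + shift i j
    cast = trans (ℤₚ.pos-+ (toℕ (residue Y)) _) (cong (λ t → + toℕ (residue Y) + t)
             (trans (ℤₚ.pos-* (toℕ (a i) ℕ.* toℕ j) s) (cong (_* σ) (ℤₚ.pos-* (toℕ (a i)) (toℕ j)))))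
    regroup : ∀ x y t z → (x - y) + ((y + t) - z) ≡ (x + t) - z
    regroup = solve-∀

  down : Fin r → Fin q → ℤ → ℤ
  down i j X = X - shift i j

  up : Fin r → Fin q → ℤ → ℤ
  up i j Y = Y + shift i j

  q∣0 : + q ∣ 0ℤ
  q∣0 = divides 0ℤ refl

  edge-down : ∀ {j} i X → j ∈ S → G (col j X) (row i (down i j X))
  edge-down {j} i X j∈S = edge i j∈S (subst (+ q ∣_) (sym (cancel X (shift i j))) q∣0)
    where
    cancel : ∀ x t → ((x - t) + t) - x ≡ 0ℤ
    cancel = solve-∀

  edge-up : ∀ {j} i Y → j ∈ S → G (row i Y) (col j (up i j Y))
  edge-up {j} i Y j∈S = edge i j∈S (subst (+ q ∣_) (sym (ℤₚ.+-inverseʳ (up i j Y))) q∣0)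

  ∤σ : ¬ + q ∣ σ
  ∤σ q∣σ = s≢0 (ℕ∣.n∣m⇒m%n≡0 s q (∣⇒∣ᵤ q∣σ))

  ∤A-A : ∀ {i i′} → i ≢ i′ → ¬ + q ∣ A i - A i′
  ∤A-A {i} {i′} i≢i′ q∣ = i≢i′ (a-injective (Fin.toℕ-injective (∣+m-+n⇒m≡n (Fin.toℕ<n (a i)) (Fin.toℕ<n (a i′)) q∣)))

  ∤J-J : ∀ {j j′} → j ≢ j′ → ¬ + q ∣ J j - J j′
  ∤J-J {j} {j′} j≢j′ q∣ = j≢j′ (Fin.toℕ-injective (∣+m-+n⇒m≡n (Fin.toℕ<n j) (Fin.toℕ<n j′) q∣))

  step : Fin r → Fin q → Fin q → ℤ
  step i j j′ = σ * (A i * (J j′ - J j))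

  rect : Fin r → Fin r → Fin q → Fin q → ℤ
  rect i i′ j j′ = σ * ((A i - A i′) * (J j - J j′))

  ∤rect : ∀ {i i′ j j′} → i ≢ i′ → j ≢ j′ → ¬ + q ∣ rect i i′ j j′
  ∤rect i≢i′ j≢j′ = ∤-* ∤σ (∤-* (∤A-A i≢i′) (∤J-J j≢j′))

  around-column : ∀ i i′ j j′ X → up i′ j (down i′ j′ (up i j′ (down i j X))) - X ≡ rect i i′ j′ j
  around-column i i′ j j′ X = rectangle (A i) (A i′) (J j) (J j′) σ X
    where
    rectangle : ∀ a a′ j j′ s x → ((((x - a * j * s) + a * j′ * s) - a′ * j′ * s) + a′ * j * s) - x
                                  ≡ s * ((a - a′) * (j′ - j))
    rectangle = solve-∀

  around-row : ∀ i i′ j j′ Y → down i j′ (up i′ j′ (down i′ j (up i j Y))) - Y ≡ rect i i′ j j′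
  around-row i i′ j j′ Y = rectangle (A i) (A i′) (J j) (J j′) σ Y
    where
    rectangle : ∀ a a′ j j′ s y → ((((y + a * j * s) - a′ * j * s) + a′ * j′ * s) - a * j′ * s) - y
                                  ≡ s * ((a - a′) * (j - j′))
    rectangle = solve-∀

  ≢-around-column : ∀ {i i′ j j′ j″} X → i ≢ i′ → j ≢ j′ →
                    (j , residue X) ≢ (j″ , residue (up i′ j″ (down i′ j′ (up i j′ (down i j X)))))
  ≢-around-column {i} {i′} {j} {j′} X i≢i′ j≢j′ eq with ,-injectiveˡ eq
  ... | refl = ∤rect i≢i′ (j≢j′ ∘ sym) (subst (+ q ∣_) (around-column i i′ j j′ X) (residue≡⇒∣ (sym (,-injectiveʳ eq))))

  ≢-around-row : ∀ {i i′ i″ j j′} Y → i ≢ i′ → j ≢ j′ →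
                 (i , residue Y) ≢ (i″ , residue (down i″ j′ (up i′ j′ (down i′ j (up i j Y)))))
  ≢-around-row {i} {i′} {i″} {j} {j′} Y i≢i′ j≢j′ eq with ,-injectiveˡ eq
  ... | refl = ∤rect i≢i′ j≢j′ (subst (+ q ∣_) (around-row i i′ j j′ Y) (residue≡⇒∣ (sym (,-injectiveʳ eq))))

  cycle₆ : ∀ {i₁ i₂ i₃ j₀ j₁ j₂} → j₀ ∈ S → j₁ ∈ S → j₂ ∈ S →
           i₁ ≢ i₂ → i₁ ≢ i₃ → i₂ ≢ i₃ → j₀ ≢ j₁ → j₀ ≢ j₂ → j₁ ≢ j₂ →
           + q ∣ step i₁ j₀ j₁ + step i₂ j₁ j₂ + step i₃ j₂ j₀ → HasCycle G 6
  cycle₆ {i₁} {i₂} {i₃} {j₀} {j₁} {j₂} j₀∈S j₁∈S j₂∈S i₁≢i₂ i₁≢i₃ i₂≢i₃ j₀≢j₁ j₀≢j₂ j₁≢j₂ q∣sum =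
    closedWalk⇒cycle {E = G} (map inj₁ columns ⋎ map inj₂ rows)
      (Unique-interleave
        (((j₀≢j₁ ∘ ,-injectiveˡ) ∷ (j₀≢j₂ ∘ ,-injectiveˡ) ∷ []) ∷ ((j₁≢j₂ ∘ ,-injectiveˡ) ∷ []) ∷ [] ∷ [])
        (((i₁≢i₂ ∘ ,-injectiveˡ) ∷ (i₁≢i₃ ∘ ,-injectiveˡ) ∷ []) ∷ ((i₂≢i₃ ∘ ,-injectiveˡ) ∷ []) ∷ [] ∷ []))
      (edge-down i₁ X₀ j₀∈S ∷ edge-up i₁ Y₁ j₁∈S ∷ edge-down i₂ X₁ j₁∈S ∷ edge-up i₂ Y₂ j₂∈S ∷ edge-down i₃ X₂ j₂∈S ∷ [-])
      (edge i₃ j₀∈S (subst (+ q ∣_) (closing (A i₁) (A i₂) (A i₃) (J j₀) (J j₁) (J j₂) σ) q∣sum))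
    where
    X₀ = 0ℤ
    Y₁ = down i₁ j₀ X₀
    X₁ = up i₁ j₁ Y₁
    Y₂ = down i₂ j₁ X₁
    X₂ = up i₂ j₂ Y₂
    Y₃ = down i₃ j₂ X₂
    columns = (j₀ , residue X₀) ∷ (j₁ , residue X₁) ∷ (j₂ , residue X₂) ∷ []
    rows = (i₁ , residue Y₁) ∷ (i₂ , residue Y₂) ∷ (i₃ , residue Y₃) ∷ []
    closing : ∀ a₁ a₂ a₃ j₀ j₁ j₂ s →
              s * (a₁ * (j₁ - j₀)) + s * (a₂ * (j₂ - j₁)) + s * (a₃ * (j₀ - j₂))
              ≡ (((((0ℤ - a₁ * j₀ * s) + a₁ * j₁ * s) - a₂ * j₁ * s) + a₂ * j₂ * s) - a₃ * j₂ * s + a₃ * j₀ * s) - 0ℤ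
    closing = solve-∀

  cycle₈ : ∀ {i₁ i₂ i₃ i₄ j₀ j₁ j₂ j₃} → j₀ ∈ S → j₁ ∈ S → j₂ ∈ S → j₃ ∈ S →
           i₁ ≢ i₂ → i₂ ≢ i₃ → i₃ ≢ i₄ → i₄ ≢ i₁ → j₀ ≢ j₁ → j₁ ≢ j₂ → j₂ ≢ j₃ → j₃ ≢ j₀ →
           + q ∣ step i₁ j₀ j₁ + step i₂ j₁ j₂ + step i₃ j₂ j₃ + step i₄ j₃ j₀ → HasCycle G 8
  cycle₈ {i₁} {i₂} {i₃} {i₄} {j₀} {j₁} {j₂} {j₃} j₀∈S j₁∈S j₂∈S j₃∈S
         i₁≢i₂ i₂≢i₃ i₃≢i₄ i₄≢i₁ j₀≢j₁ j₁≢j₂ j₂≢j₃ j₃≢j₀ q∣sum =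
    closedWalk⇒cycle {E = G} (map inj₁ columns ⋎ map inj₂ rows)
      (Unique-interleave
        (((j₀≢j₁ ∘ ,-injectiveˡ) ∷ ≢-around-column X₀ i₁≢i₂ j₀≢j₁ ∷ ((j₃≢j₀ ∘ sym) ∘ ,-injectiveˡ) ∷ [])
         ∷ ((j₁≢j₂ ∘ ,-injectiveˡ) ∷ ≢-around-column X₁ i₂≢i₃ j₁≢j₂ ∷ [])
         ∷ ((j₂≢j₃ ∘ ,-injectiveˡ) ∷ []) ∷ [] ∷ [])
        (((i₁≢i₂ ∘ ,-injectiveˡ) ∷ ≢-around-row Y₁ i₁≢i₂ j₁≢j₂ ∷ ((i₄≢i₁ ∘ sym) ∘ ,-injectiveˡ) ∷ [])
         ∷ ((i₂≢i₃ ∘ ,-injectiveˡ) ∷ ≢-around-row Y₂ i₂≢i₃ j₂≢j₃ ∷ [])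
         ∷ ((i₃≢i₄ ∘ ,-injectiveˡ) ∷ []) ∷ [] ∷ []))
      (edge-down i₁ X₀ j₀∈S ∷ edge-up i₁ Y₁ j₁∈S ∷ edge-down i₂ X₁ j₁∈S ∷ edge-up i₂ Y₂ j₂∈S
        ∷ edge-down i₃ X₂ j₂∈S ∷ edge-up i₃ Y₃ j₃∈S ∷ edge-down i₄ X₃ j₃∈S ∷ [-])
      (edge i₄ j₀∈S (subst (+ q ∣_) (closing (A i₁) (A i₂) (A i₃) (A i₄) (J j₀) (J j₁) (J j₂) (J j₃) σ) q∣sum))
    where
    X₀ = 0ℤ
    Y₁ = down i₁ j₀ X₀
    X₁ = up i₁ j₁ Y₁
    Y₂ = down i₂ j₁ X₁
    X₂ = up i₂ j₂ Y₂
    Y₃ = down i₃ j₂ X₂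
    X₃ = up i₃ j₃ Y₃
    Y₄ = down i₄ j₃ X₃
    columns = (j₀ , residue X₀) ∷ (j₁ , residue X₁) ∷ (j₂ , residue X₂) ∷ (j₃ , residue X₃) ∷ []
    rows = (i₁ , residue Y₁) ∷ (i₂ , residue Y₂) ∷ (i₃ , residue Y₃) ∷ (i₄ , residue Y₄) ∷ []
    closing : ∀ a₁ a₂ a₃ a₄ j₀ j₁ j₂ j₃ s →
              s * (a₁ * (j₁ - j₀)) + s * (a₂ * (j₂ - j₁)) + s * (a₃ * (j₃ - j₂)) + s * (a₄ * (j₀ - j₃))
              ≡ (((((((0ℤ - a₁ * j₀ * s) + a₁ * j₁ * s) - a₂ * j₁ * s) + a₂ * j₂ * s) - a₃ * j₂ * s) + a₃ * j₃ * s)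
                   - a₄ * j₃ * s + a₄ * j₀ * s) - 0ℤ
    closing = solve-∀

  rect-injective : ¬ HasCycle G 6 → ∀ {i₀ i i′ j₀ j j′} → j₀ ∈ S → j ∈ S → j′ ∈ S →
                   i ≢ i₀ → i′ ≢ i₀ → j ≢ j₀ → j′ ≢ j₀ →
                   + q ∣ rect i i₀ j j₀ - rect i′ i₀ j′ j₀ → i ≡ i′ × j ≡ j′
  rect-injective no-6-cycle {i₀} {i} {i′} {j₀} {j} {j′} j₀∈S j∈S j′∈S i≢i₀ i′≢i₀ j≢j₀ j′≢j₀ q∣diff
    with i Fin.≟ i′ | j Fin.≟ j′
  ... | yes refl | yes refl = refl , refl
  ... | yes refl | no j≢j′  = ⊥-elim (∤rect i≢i₀ j≢j′ (subst (+ q ∣_) (rectangle (A i) (A i₀) (J j) (J j′) (J j₀) σ) q∣diff))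
    where
    rectangle : ∀ a a₀ j j′ j₀ s → s * ((a - a₀) * (j - j₀)) - s * ((a - a₀) * (j′ - j₀)) ≡ s * ((a - a₀) * (j - j′))
    rectangle = solve-∀
  ... | no i≢i′  | yes refl = ⊥-elim (∤rect i≢i′ j≢j₀ (subst (+ q ∣_) (rectangle (A i) (A i′) (A i₀) (J j) (J j₀) σ) q∣diff))
    where
    rectangle : ∀ a a′ a₀ j j₀ s → s * ((a - a₀) * (j - j₀)) - s * ((a′ - a₀) * (j - j₀)) ≡ s * ((a - a′) * (j - j₀))
    rectangle = solve-∀
  ... | no i≢i′  | no j≢j′  =
    ⊥-elim (no-6-cycle (cycle₆ j₀∈S j∈S j′∈S i≢i₀ i≢i′ (i′≢i₀ ∘ sym) (j≢j₀ ∘ sym) (j′≢j₀ ∘ sym) j≢j′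
                                 (subst (+ q ∣_) (hexagon (A i) (A i′) (A i₀) (J j) (J j′) (J j₀) σ) q∣diff)))
    where
    hexagon : ∀ a a′ a₀ j j′ j₀ s → s * ((a - a₀) * (j - j₀)) - s * ((a′ - a₀) * (j′ - j₀))
                                  ≡ s * (a * (j - j₀)) + s * (a₀ * (j′ - j)) + s * (a′ * (j₀ - j′))
    hexagon = solve-∀

  ∤walk₄-closing : ∀ {i₁ i₂ j₀ j₁ j₂} → i₁ ≢ i₂ → j₀ ≢ j₁ → j₂ ≡ j₀ → ¬ + q ∣ step i₁ j₀ j₁ + step i₂ j₁ j₂
  ∤walk₄-closing {i₁} {i₂} {j₀} {j₁} i₁≢i₂ j₀≢j₁ refl q∣ =
    ∤rect i₁≢i₂ (j₀≢j₁ ∘ sym) (subst (+ q ∣_) (rectangle (A i₁) (A i₂) (J j₀) (J j₁) σ) q∣)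
    where
    rectangle : ∀ a₁ a₂ j₀ j₁ s → s * (a₁ * (j₁ - j₀)) + s * (a₂ * (j₀ - j₁)) ≡ s * ((a₁ - a₂) * (j₁ - j₀))
    rectangle = solve-∀

  walk₂-injective : ∀ {i i′ j₀ j₁} → j₀ ≢ j₁ → + q ∣ step i j₀ j₁ - step i′ j₀ j₁ → i ≡ i′
  walk₂-injective {i} {i′} {j₀} {j₁} j₀≢j₁ q∣diff with i Fin.≟ i′
  ... | yes i≡i′ = i≡i′
  ... | no i≢i′  = ⊥-elim (∤rect i≢i′ (j₀≢j₁ ∘ sym) (subst (+ q ∣_) (rectangle (A i) (A i′) (J j₀) (J j₁) σ) q∣diff))
    where
    rectangle : ∀ a a′ j₀ j₁ s → s * (a * (j₁ - j₀)) - s * (a′ * (j₁ - j₀)) ≡ s * ((a - a′) * (j₁ - j₀))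
    rectangle = solve-∀

  ∤walk₂-walk₄ : ¬ HasCycle G 6 → ∀ {i i₁ i₂ j₀ j₁ j₂ j} → j₀ ∈ S → j₁ ∈ S → j₂ ∈ S →
                 i₁ ≢ i₂ → j₀ ≢ j₁ → j₁ ≢ j₂ → j₀ ≢ j₂ → j ≡ j₂ →
                 ¬ + q ∣ step i j₀ j - (step i₁ j₀ j₁ + step i₂ j₁ j₂)
  ∤walk₂-walk₄ no-6-cycle {i} {i₁} {i₂} {j₀} {j₁} {j₂} j₀∈S j₁∈S j₂∈S i₁≢i₂ j₀≢j₁ j₁≢j₂ j₀≢j₂ refl q∣diff
    with i Fin.≟ i₁ | i Fin.≟ i₂
  ... | yes refl | _        =
    ∤rect i₁≢i₂ (j₁≢j₂ ∘ sym) (subst (+ q ∣_) (rectangle (A i) (A i₂) (J j₀) (J j₁) (J j₂) σ) q∣diff)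
    where
    rectangle : ∀ a₁ a₂ j₀ j₁ j₂ s → s * (a₁ * (j₂ - j₀)) - (s * (a₁ * (j₁ - j₀)) + s * (a₂ * (j₂ - j₁)))
                                    ≡ s * ((a₁ - a₂) * (j₂ - j₁))
    rectangle = solve-∀
  ... | no _     | yes refl =
    ∤rect (i₁≢i₂ ∘ sym) (j₀≢j₁ ∘ sym) (subst (+ q ∣_) (rectangle (A i₁) (A i) (J j₀) (J j₁) (J j₂) σ) q∣diff)
    where
    rectangle : ∀ a₁ a₂ j₀ j₁ j₂ s → s * (a₂ * (j₂ - j₀)) - (s * (a₁ * (j₁ - j₀)) + s * (a₂ * (j₂ - j₁)))
                                    ≡ s * ((a₂ - a₁) * (j₁ - j₀))
    rectangle = solve-∀
  ... | no i≢i₁  | no i≢i₂  = no-6-cycle (cycle₆ j₀∈S j₁∈S j₂∈S i₁≢i₂ (i≢i₁ ∘ sym) (i≢i₂ ∘ sym) j₀≢j₁ j₀≢j₂ j₁≢j₂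
                                 (subst (+ q ∣_) (hexagon (A i) (A i₁) (A i₂) (J j₀) (J j₁) (J j₂) σ) (∣m⇒∣-m q∣diff)))
    where
    hexagon : ∀ a a₁ a₂ j₀ j₁ j₂ s → - (s * (a * (j₂ - j₀)) - (s * (a₁ * (j₁ - j₀)) + s * (a₂ * (j₂ - j₁))))
                                    ≡ s * (a₁ * (j₁ - j₀)) + s * (a₂ * (j₂ - j₁)) + s * (a * (j₀ - j₂))
    hexagon = solve-∀

  walk₄-injective-same-first-row : ¬ HasCycle G 6 → ∀ {i₁ i₂ i₂′ j₀ j₁ j₁′ j₂} → j₁ ∈ S → j₁′ ∈ S → j₂ ∈ S →
                                   i₁ ≢ i₂ → i₁ ≢ i₂′ → j₁ ≢ j₂ → j₁′ ≢ j₂ →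
                                   + q ∣ (step i₁ j₀ j₁ + step i₂ j₁ j₂) - (step i₁ j₀ j₁′ + step i₂′ j₁′ j₂) →
                                   j₁ ≡ j₁′ × i₂ ≡ i₂′
  walk₄-injective-same-first-row no-6-cycle {i₁} {i₂} {i₂′} {j₀} {j₁} {j₁′} {j₂}
                                 j₁∈S j₁′∈S j₂∈S i₁≢i₂ i₁≢i₂′ j₁≢j₂ j₁′≢j₂ q∣diff
    with i₂ Fin.≟ i₂′ | j₁ Fin.≟ j₁′
  ... | yes refl | yes refl = refl , refl
  ... | yes refl | no j₁≢j₁′ =
    ⊥-elim (∤rect i₁≢i₂ j₁≢j₁′ (subst (+ q ∣_) (rectangle (A i₁) (A i₂) (J j₀) (J j₁) (J j₁′) (J j₂) σ) q∣diff))
    where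
    rectangle : ∀ a₁ a₂ j₀ j₁ j₁′ j₂ s →
                (s * (a₁ * (j₁ - j₀)) + s * (a₂ * (j₂ - j₁))) - (s * (a₁ * (j₁′ - j₀)) + s * (a₂ * (j₂ - j₁′)))
                ≡ s * ((a₁ - a₂) * (j₁ - j₁′))
    rectangle = solve-∀
  ... | no i₂≢i₂′ | yes refl =
    ⊥-elim (∤rect i₂≢i₂′ (j₁≢j₂ ∘ sym) (subst (+ q ∣_) (rectangle (A i₁) (A i₂) (A i₂′) (J j₀) (J j₁) (J j₂) σ) q∣diff))
    where
    rectangle : ∀ a₁ a₂ a₂′ j₀ j₁ j₂ s →
                (s * (a₁ * (j₁ - j₀)) + s * (a₂ * (j₂ - j₁))) - (s * (a₁ * (j₁ - j₀)) + s * (a₂′ * (j₂ - j₁)))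
                ≡ s * ((a₂ - a₂′) * (j₂ - j₁))
    rectangle = solve-∀
  ... | no i₂≢i₂′ | no j₁≢j₁′ =
    ⊥-elim (no-6-cycle (cycle₆ j₁∈S j₂∈S j₁′∈S i₂≢i₂′ (i₁≢i₂ ∘ sym) (i₁≢i₂′ ∘ sym) j₁≢j₂ j₁≢j₁′ (j₁′≢j₂ ∘ sym)
      (subst (+ q ∣_) (hexagon (A i₁) (A i₂) (A i₂′) (J j₀) (J j₁) (J j₁′) (J j₂) σ) q∣diff)))
    where
    hexagon : ∀ a₁ a₂ a₂′ j₀ j₁ j₁′ j₂ s →
              (s * (a₁ * (j₁ - j₀)) + s * (a₂ * (j₂ - j₁))) - (s * (a₁ * (j₁′ - j₀)) + s * (a₂′ * (j₂ - j₁′)))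
              ≡ s * (a₂ * (j₂ - j₁)) + s * (a₂′ * (j₁′ - j₂)) + s * (a₁ * (j₁ - j₁′))
    hexagon = solve-∀

  ∤walk₄-different-first-rows : ¬ HasCycle G 6 → ¬ HasCycle G 8 → ∀ {i₁ i₂ i₁′ i₂′ j₀ j₁ j₁′ j₂} →
                                j₀ ∈ S → j₁ ∈ S → j₁′ ∈ S → j₂ ∈ S →
                                i₁ ≢ i₁′ → i₁ ≢ i₂ → i₁′ ≢ i₂′ → j₀ ≢ j₁ → j₀ ≢ j₁′ → j₁ ≢ j₂ → j₁′ ≢ j₂ →
                                ¬ + q ∣ (step i₁ j₀ j₁ + step i₂ j₁ j₂) - (step i₁′ j₀ j₁′ + step i₂′ j₁′ j₂)
  ∤walk₄-different-first-rows no-6-cycle no-8-cycle {i₁} {i₂} {i₁′} {i₂′} {j₀} {j₁} {j₁′} {j₂}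
                              j₀∈S j₁∈S j₁′∈S j₂∈S i₁≢i₁′ i₁≢i₂ i₁′≢i₂′ j₀≢j₁ j₀≢j₁′ j₁≢j₂ j₁′≢j₂ q∣diff
    with i₂ Fin.≟ i₂′ | j₁ Fin.≟ j₁′
  ... | yes refl | yes refl =
    ∤rect i₁≢i₁′ (j₀≢j₁ ∘ sym) (subst (+ q ∣_) (rectangle (A i₁) (A i₁′) (A i₂) (J j₀) (J j₁) (J j₂) σ) q∣diff)
    where
    rectangle : ∀ a₁ a₁′ a₂ j₀ j₁ j₂ s →
                (s * (a₁ * (j₁ - j₀)) + s * (a₂ * (j₂ - j₁))) - (s * (a₁′ * (j₁ - j₀)) + s * (a₂ * (j₂ - j₁)))
                ≡ s * ((a₁ - a₁′) * (j₁ - j₀))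
    rectangle = solve-∀
  ... | yes refl | no j₁≢j₁′ =
    no-6-cycle (cycle₆ j₀∈S j₁∈S j₁′∈S i₁≢i₂ i₁≢i₁′ (i₁′≢i₂′ ∘ sym) j₀≢j₁ j₀≢j₁′ j₁≢j₁′
      (subst (+ q ∣_) (hexagon (A i₁) (A i₁′) (A i₂) (J j₀) (J j₁) (J j₁′) (J j₂) σ) q∣diff))
    where
    hexagon : ∀ a₁ a₁′ a₂ j₀ j₁ j₁′ j₂ s →
              (s * (a₁ * (j₁ - j₀)) + s * (a₂ * (j₂ - j₁))) - (s * (a₁′ * (j₁′ - j₀)) + s * (a₂ * (j₂ - j₁′)))
              ≡ s * (a₁ * (j₁ - j₀)) + s * (a₂ * (j₁′ - j₁)) + s * (a₁′ * (j₀ - j₁′))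
    hexagon = solve-∀
  ... | no i₂≢i₂′ | _ =
    no-8-cycle (cycle₈ j₀∈S j₁∈S j₂∈S j₁′∈S i₁≢i₂ i₂≢i₂′ (i₁′≢i₂′ ∘ sym) (i₁≢i₁′ ∘ sym)
                       j₀≢j₁ j₁≢j₂ (j₁′≢j₂ ∘ sym) (j₀≢j₁′ ∘ sym)
      (subst (+ q ∣_) (octagon (A i₁) (A i₁′) (A i₂) (A i₂′) (J j₀) (J j₁) (J j₁′) (J j₂) σ) q∣diff))
    where
    octagon : ∀ a₁ a₁′ a₂ a₂′ j₀ j₁ j₁′ j₂ s →
              (s * (a₁ * (j₁ - j₀)) + s * (a₂ * (j₂ - j₁))) - (s * (a₁′ * (j₁′ - j₀)) + s * (a₂′ * (j₂ - j₁′)))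
              ≡ s * (a₁ * (j₁ - j₀)) + s * (a₂ * (j₂ - j₁)) + s * (a₂′ * (j₁′ - j₂)) + s * (a₁′ * (j₀ - j₁′))
    octagon = solve-∀

  walk₄-injective : ¬ HasCycle G 6 → ¬ HasCycle G 8 → ∀ {i₁ i₂ i₁′ i₂′ j₀ j₁ j₁′ j₂ j₂′} →
                    j₀ ∈ S → j₁ ∈ S → j₁′ ∈ S → j₂ ∈ S →
                    i₁ ≢ i₂ → i₁′ ≢ i₂′ → j₀ ≢ j₁ → j₀ ≢ j₁′ → j₁ ≢ j₂ → j₁′ ≢ j₂′ → j₂ ≡ j₂′ →
                    + q ∣ (step i₁ j₀ j₁ + step i₂ j₁ j₂) - (step i₁′ j₀ j₁′ + step i₂′ j₁′ j₂′) →
                    i₁ ≡ i₁′ × j₁ ≡ j₁′ × i₂ ≡ i₂′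
  walk₄-injective no-6-cycle no-8-cycle {i₁} {i₂} {i₁′} {i₂′} {j₀}
                  j₀∈S j₁∈S j₁′∈S j₂∈S i₁≢i₂ i₁′≢i₂′ j₀≢j₁ j₀≢j₁′ j₁≢j₂ j₁′≢j₂ refl q∣diff
    with i₁ Fin.≟ i₁′
  ... | yes refl  =
    refl , walk₄-injective-same-first-row no-6-cycle {j₀ = j₀} j₁∈S j₁′∈S j₂∈S i₁≢i₂ i₁′≢i₂′ j₁≢j₂ j₁′≢j₂ q∣diff
  ... | no i₁≢i₁′ = ⊥-elim (∤walk₄-different-first-rows no-6-cycle no-8-cycle j₀∈S j₁∈S j₁′∈S j₂∈S
                              i₁≢i₁′ i₁≢i₂ i₁′≢i₂′ j₀≢j₁ j₀≢j₁′ j₁≢j₂ j₁′≢j₂ q∣diff)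

module Counting (q : ℕ) (q-prime : Prime q) .{{_ : NonZero q}} (s : ℕ) (s≢0 : s ℕ.% q ≢ 0)
                {r′ : ℕ} (a : Fin (suc r′) → Fin q) (a-injective : Injective _≡_ _≡_ a) (S : Subset q)
                {m : ℕ} (column : Fin (suc m) → Fin q) (column-injective : Injective _≡_ _≡_ column)
                (column-∈ : ∀ k → column k ∈ S) where
  open ℤ using (ℤ; 0ℤ; _+_)
  open Congruence q q-prime
  open TannerGraph q q-prime s s≢0 a a-injective S

  j₀ : Fin q
  j₀ = column Fin.zero

  column-≢ : ∀ {k k′} → k ≢ k′ → column k ≢ column k′
  column-≢ k≢k′ = k≢k′ ∘ column-injective

  -- (t , k) stands for the closed walk j₀ → row t + 1 → column k + 1 → row 0 → j₀.
  rectangleResidue : ⊤ ⊎ (Fin r′ × Fin m) → Fin q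
  rectangleResidue (inj₁ _)       = residue 0ℤ
  rectangleResidue (inj₂ (t , k)) = residue (rect (Fin.suc t) Fin.zero (column (Fin.suc k)) j₀)

  rectangleResidue-injective : ¬ HasCycle G 6 → Injective _≡_ _≡_ rectangleResidue
  rectangleResidue-injective _ {inj₁ _} {inj₁ _} _ = refl
  rectangleResidue-injective _ {inj₁ _} {inj₂ _} eq =
    ⊥-elim (∤rect (Fin.0≢1+n ∘ sym) (column-≢ (Fin.0≢1+n ∘ sym)) (residue≡residue0⇒∣ (sym eq)))
  rectangleResidue-injective _ {inj₂ _} {inj₁ _} eq =
    ⊥-elim (∤rect (Fin.0≢1+n ∘ sym) (column-≢ (Fin.0≢1+n ∘ sym)) (residue≡residue0⇒∣ eq))
  rectangleResidue-injective no-6-cycle {inj₂ (t , k)} {inj₂ (t′ , k′)} eq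
    with rect-injective no-6-cycle (column-∈ Fin.zero) (column-∈ (Fin.suc k)) (column-∈ (Fin.suc k′))
           (Fin.0≢1+n ∘ sym) (Fin.0≢1+n ∘ sym) (column-≢ (Fin.0≢1+n ∘ sym)) (column-≢ (Fin.0≢1+n ∘ sym)) (residue≡⇒∣ eq)
  ... | i≡i′ , j≡j′ with Fin.suc-injective i≡i′ | Fin.suc-injective (column-injective j≡j′)
  ... | refl | refl = refl

  count₆ : ¬ HasCycle G 6 → 1 ℕ.+ r′ ℕ.* m ℕ.≤ q
  count₆ no-6-cycle = ↣⇒≤ ((Fin.1↔⊤ ⊎-↔ Fin.*↔×) ↔-∘ Fin.+↔⊎) ↔-refl (mk↣ (rectangleResidue-injective no-6-cycle))

  -- The non-backtracking walks from column j₀ of length 0, 2 and 4; the second row and column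
  -- are given through punchIn, so that they differ from the first ones.
  Walk : Set
  Walk = ⊤ ⊎ (Fin (suc r′) × Fin m) ⊎ ((Fin (suc r′) × Fin m) × (Fin r′ × Fin m))

  end : Walk → Fin (suc m)
  end (inj₁ _)                             = Fin.zero
  end (inj₂ (inj₁ (i₁ , k₁)))              = Fin.suc k₁
  end (inj₂ (inj₂ ((i₁ , k₁) , (t , k₂)))) = Fin.punchIn (Fin.suc k₁) k₂

  position : Walk → ℤ
  position (inj₁ _)                             = 0ℤ
  position (inj₂ (inj₁ (i₁ , k₁)))              = step i₁ j₀ (column (Fin.suc k₁))
  position (inj₂ (inj₂ ((i₁ , k₁) , (t , k₂)))) =
    step i₁ j₀ (column (Fin.suc k₁)) + step (Fin.punchIn i₁ t) (column (Fin.suc k₁)) (column (Fin.punchIn (Fin.suc k₁) k₂))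

  endpoint : Walk → Fin (suc m) × Fin q
  endpoint w = end w , residue (position w)

  i₁≢i₂ : ∀ (i₁ : Fin (suc r′)) t → i₁ ≢ Fin.punchIn i₁ t
  i₁≢i₂ i₁ t = Fin.punchInᵢ≢i i₁ t ∘ sym

  j₀≢j₁ : ∀ (k₁ : Fin m) → j₀ ≢ column (Fin.suc k₁)
  j₀≢j₁ k₁ = column-≢ Fin.0≢1+n

  j₁≢j₂ : ∀ (k₁ k₂ : Fin m) → column (Fin.suc k₁) ≢ column (Fin.punchIn (Fin.suc k₁) k₂)
  j₁≢j₂ k₁ k₂ = column-≢ (Fin.punchInᵢ≢i (Fin.suc k₁) k₂ ∘ sym)

  endpoint₀≢endpoint₄ : ∀ {i₁ k₁ t k₂} → Fin.zero ≡ Fin.punchIn (Fin.suc k₁) k₂ →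
                        residue 0ℤ ≢ residue (position (inj₂ (inj₂ ((i₁ , k₁) , (t , k₂)))))
  endpoint₀≢endpoint₄ {i₁} {k₁} {t} {k₂} end≡ res≡ =
    ∤walk₄-closing (i₁≢i₂ i₁ t) (j₀≢j₁ k₁) (cong column (sym end≡)) (residue≡residue0⇒∣ (sym res≡))

  endpoint₂≢endpoint₄ : ¬ HasCycle G 6 → ∀ {i k i₁ k₁ t k₂} → Fin.suc k ≡ Fin.punchIn (Fin.suc k₁) k₂ →
                        residue (position (inj₂ (inj₁ (i , k)))) ≢ residue (position (inj₂ (inj₂ ((i₁ , k₁) , (t , k₂)))))
  endpoint₂≢endpoint₄ no-6-cycle {i} {k} {i₁} {k₁} {t} {k₂} end≡ res≡ =
    ∤walk₂-walk₄ no-6-cycle (column-∈ Fin.zero) (column-∈ (Fin.suc k₁)) (column-∈ (Fin.punchIn (Fin.suc k₁) k₂))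
      (i₁≢i₂ i₁ t) (j₀≢j₁ k₁) (j₁≢j₂ k₁ k₂) (column-≢ (λ 0≡ → Fin.0≢1+n (trans 0≡ (sym end≡))))
      (cong column end≡) (residue≡⇒∣ res≡)

  endpoint₄-injective : ¬ HasCycle G 6 → ¬ HasCycle G 8 → ∀ {i₁ k₁ t k₂ i₁′ k₁′ t′ k₂′} →
                        Fin.punchIn (Fin.suc k₁) k₂ ≡ Fin.punchIn (Fin.suc k₁′) k₂′ →
                        residue (position (inj₂ (inj₂ ((i₁ , k₁) , (t , k₂)))))
                          ≡ residue (position (inj₂ (inj₂ ((i₁′ , k₁′) , (t′ , k₂′))))) →
                        ((i₁ , k₁) , (t , k₂)) ≡ ((i₁′ , k₁′) , (t′ , k₂′))
  endpoint₄-injective no-6-cycle no-8-cycle {i₁} {k₁} {t} {k₂} {i₁′} {k₁′} {t′} {k₂′} end≡ res≡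
    with walk₄-injective no-6-cycle no-8-cycle (column-∈ Fin.zero) (column-∈ (Fin.suc k₁)) (column-∈ (Fin.suc k₁′))
           (column-∈ (Fin.punchIn (Fin.suc k₁) k₂)) (i₁≢i₂ i₁ t) (i₁≢i₂ i₁′ t′) (j₀≢j₁ k₁) (j₀≢j₁ k₁′)
           (j₁≢j₂ k₁ k₂) (j₁≢j₂ k₁′ k₂′) (cong column end≡) (residue≡⇒∣ res≡)
  ... | refl , j₁≡j₁′ , i₂≡i₂′ with Fin.suc-injective (column-injective j₁≡j₁′)
  ... | refl with Fin.punchIn-injective i₁ t t′ i₂≡i₂′ | Fin.punchIn-injective (Fin.suc k₁) k₂ k₂′ end≡
  ... | refl | refl = refl

  endpoint-injective : ¬ HasCycle G 6 → ¬ HasCycle G 8 → Injective _≡_ _≡_ endpoint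
  endpoint-injective _ _ {inj₁ _} {inj₁ _} _ = refl
  endpoint-injective _ _ {inj₁ _} {inj₂ (inj₁ _)} ()
  endpoint-injective _ _ {inj₂ (inj₁ _)} {inj₁ _} ()
  endpoint-injective _ _ {inj₁ _} {inj₂ (inj₂ _)} eq = ⊥-elim (endpoint₀≢endpoint₄ (,-injectiveˡ eq) (,-injectiveʳ eq))
  endpoint-injective _ _ {inj₂ (inj₂ _)} {inj₁ _} eq =
    ⊥-elim (endpoint₀≢endpoint₄ (sym (,-injectiveˡ eq)) (sym (,-injectiveʳ eq)))
  endpoint-injective _ _ {inj₂ (inj₁ (i , k))} {inj₂ (inj₁ (i′ , k′))} eq with Fin.suc-injective (,-injectiveˡ eq)
  ... | refl = cong (λ i → inj₂ (inj₁ (i , k))) (walk₂-injective (j₀≢j₁ k) (residue≡⇒∣ (,-injectiveʳ eq)))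
  endpoint-injective no-6-cycle _ {inj₂ (inj₁ _)} {inj₂ (inj₂ _)} eq =
    ⊥-elim (endpoint₂≢endpoint₄ no-6-cycle (,-injectiveˡ eq) (,-injectiveʳ eq))
  endpoint-injective no-6-cycle _ {inj₂ (inj₂ _)} {inj₂ (inj₁ _)} eq =
    ⊥-elim (endpoint₂≢endpoint₄ no-6-cycle (sym (,-injectiveˡ eq)) (sym (,-injectiveʳ eq)))
  endpoint-injective no-6-cycle no-8-cycle {inj₂ (inj₂ _)} {inj₂ (inj₂ _)} eq =
    cong (inj₂ ∘ inj₂) (endpoint₄-injective no-6-cycle no-8-cycle (,-injectiveˡ eq) (,-injectiveʳ eq))

  count₆₈ : ¬ HasCycle G 6 → ¬ HasCycle G 8 →
            1 ℕ.+ (suc r′ ℕ.* m ℕ.+ suc r′ ℕ.* m ℕ.* (r′ ℕ.* m)) ℕ.≤ suc m ℕ.* q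
  count₆₈ no-6-cycle no-8-cycle =
    ↣⇒≤ ((Fin.1↔⊤ ⊎-↔ ((Fin.*↔× ⊎-↔ ((Fin.*↔× ×-↔ Fin.*↔×) ↔-∘ Fin.*↔×)) ↔-∘ Fin.+↔⊎)) ↔-∘ Fin.+↔⊎)
        (↔-sym Fin.*↔×) (mk↣ (endpoint-injective no-6-cycle no-8-cycle))

module QuadraticBound where
  open ℤ using (ℤ; +_; _+_; _*_; _-_; -_; _≤_; +≤+)

  -- For R = + suc r′ the term + 2 * R is definitionally equal to the statement term + (2 * suc r′).
  rootA : ℤ → ℤ → ℤ
  rootA Q R = Q + R * (+ 2 * R - + 3)

  discriminant : ℤ → ℤ → ℤ
  discriminant Q R = rootA Q R * rootA Q R - + 4 * R * ((R - + 1) * (R - + 1) * (R - + 1))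

  denominator : ℤ → ℤ
  denominator R = + 2 * R * (R - + 1)

  RootBound : ℕ → ℤ → ℤ → Set
  RootBound n Q R = LeRootBound n (rootA Q R) (discriminant Q R) (denominator R)

  0≤+ : ∀ {i j} → + 0 ≤ i → + 0 ≤ j → + 0 ≤ i + j
  0≤+ = ℤₚ.+-mono-≤

  0≤* : ∀ {i j} → + 0 ≤ i → + 0 ≤ j → + 0 ≤ i * j
  0≤* {+ m} {+ n} (+≤+ _) (+≤+ _) = subst (+ 0 ≤_) (ℤₚ.pos-* m n) (+≤+ z≤n)

  i≤i+j : ∀ {i j} → + 0 ≤ j → i ≤ i + j
  i≤i+j {i} 0≤j = subst (_≤ i + _) (ℤₚ.+-identityʳ i) (ℤₚ.+-monoʳ-≤ i 0≤j)

  module _ {Q R : ℤ} (1≤R : + 1 ≤ R) (R≤Q : R ≤ Q) where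

    0≤R : + 0 ≤ R
    0≤R = ℤₚ.≤-trans (+≤+ z≤n) 1≤R

    0≤R-1 : + 0 ≤ R - + 1
    0≤R-1 = ℤₚ.i≤j⇒0≤j-i 1≤R

    0≤Q-R : + 0 ≤ Q - R
    0≤Q-R = ℤₚ.i≤j⇒0≤j-i R≤Q

    0≤4R[R-1] : + 0 ≤ + 4 * R * (R - + 1)
    0≤4R[R-1] = 0≤* (0≤* (+≤+ (z≤n {4})) 0≤R) 0≤R-1

    discriminant≥0 : + 0 ≤ discriminant Q R
    discriminant≥0 = subst (+ 0 ≤_) (sym (expand Q R))
      (0≤+ (0≤+ (0≤* 0≤Q-R 0≤Q-R) (0≤* 0≤4R[R-1] 0≤Q-R)) (0≤* 0≤4R[R-1] 0≤R-1))
      where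
      expand : ∀ Q R →
               (Q + R * (+ 2 * R - + 3)) * (Q + R * (+ 2 * R - + 3)) - + 4 * R * ((R - + 1) * (R - + 1) * (R - + 1))
               ≡ (Q - R) * (Q - R) + + 4 * R * (R - + 1) * (Q - R) + + 4 * R * (R - + 1) * (R - + 1)
      expand = solve-∀

    rootBound-zero : RootBound 0 Q R
    rootBound-zero = discriminant≥0 , inj₁ (subst (_≤ + 0) (sym (expand Q R))
      (ℤₚ.neg-mono-≤ (0≤+ 0≤Q-R (0≤* (0≤* (+≤+ (z≤n {2})) 0≤R) 0≤R-1))))
      where
      expand : ∀ Q R → + 2 * R * (R - + 1) * + 0 - (Q + R * (+ 2 * R - + 3)) ≡ - ((Q - R) + + 2 * R * (R - + 1))
      expand = solve-∀

    -- D − (B n − A)² = 4R(R − 1)·(n Q − (1 + R m + R(R − 1) m²)) for n = m + 1.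
    rootBound-suc : ∀ m → + 1 + (R * + m + R * + m * ((R - + 1) * + m)) ≤ (+ 1 + + m) * Q → RootBound (suc m) Q R
    rootBound-suc m count = discriminant≥0 , inj₂ (subst (excess * excess ≤_) (sym (expand Q R (+ m)))
      (i≤i+j (0≤* 0≤4R[R-1] (ℤₚ.i≤j⇒0≤j-i count))))
      where
      excess : ℤ
      excess = denominator R * + suc m - rootA Q R
      expand : ∀ Q R M →
               (Q + R * (+ 2 * R - + 3)) * (Q + R * (+ 2 * R - + 3)) - + 4 * R * ((R - + 1) * (R - + 1) * (R - + 1))
               ≡ (+ 2 * R * (R - + 1) * (+ 1 + M) - (Q + R * (+ 2 * R - + 3)))
                 * (+ 2 * R * (R - + 1) * (+ 1 + M) - (Q + R * (+ 2 * R - + 3)))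
                 + + 4 * R * (R - + 1) * ((+ 1 + M) * Q - (+ 1 + (R * M + R * M * ((R - + 1) * M))))
      expand = solve-∀

open import Data.Nat using (_+_; _*_; _∸_; _%_; _≤_)
open import Data.Fin.Subset using (∣_∣)
open ℤ using (+_)
open QuadraticBound using (RootBound; rootBound-zero; rootBound-suc)

count-cast : ∀ r′ m → + (suc r′ * m + suc r′ * m * (r′ * m)) ≡ + suc r′ ℤ.* + m ℤ.+ + suc r′ ℤ.* + m ℤ.* (+ r′ ℤ.* + m)
count-cast r′ m = trans (ℤₚ.pos-+ (suc r′ * m) _)
  (cong₂ ℤ._+_ (ℤₚ.pos-* (suc r′) m)
    (trans (ℤₚ.pos-* (suc r′ * m) (r′ * m)) (cong₂ ℤ._*_ (ℤₚ.pos-* (suc r′) m) (ℤₚ.pos-* r′ m))))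

girthBounds : (q : ℕ) → Prime q → .{{_ : NonZero q}} → (s : ℕ) → s % q ≢ 0 →
              {r′ : ℕ} (a : Fin (suc r′) → Fin q) → Injective _≡_ _≡_ a → (S : Subset q) →
              {n : ℕ} (column : Fin n → Fin q) → Injective _≡_ _≡_ column → (∀ k → column k ∈ S) →
              (HasGirth (Adj q s a S) 8 → n * r′ ≤ r′ + (q ∸ 1))
              × (HasGirth (Adj q s a S) 10 → RootBound n (+ q) (+ suc r′))
girthBounds q q-prime s s≢0 a a-injective S {zero} _ _ _ =
  (λ _ → z≤n) , (λ _ → rootBound-zero (ℤ.+≤+ (s≤s z≤n)) (ℤ.+≤+ (Fin.injective⇒≤ a-injective)))
girthBounds q q-prime s s≢0 {r′} a a-injective S {suc m} column column-injective column-∈ = girth-8-bound , girth-10-bound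
  where
  open Counting q q-prime s s≢0 a a-injective S column column-injective column-∈

  girth-8-bound : HasGirth (Adj q s a S) 8 → suc m * r′ ≤ r′ + (q ∸ 1)
  girth-8-bound girth = ℕₚ.+-monoʳ-≤ r′ (subst (_≤ q ∸ 1) (ℕₚ.*-comm r′ m)
    (ℕₚ.∸-monoˡ-≤ 1 (count₆ (shorter-cycles {E = Adj q s a S} girth 6))))

  girth-10-bound : HasGirth (Adj q s a S) 10 → RootBound (suc m) (+ q) (+ suc r′)
  girth-10-bound girth = rootBound-suc (ℤ.+≤+ (s≤s z≤n)) (ℤ.+≤+ (Fin.injective⇒≤ a-injective)) m
    (subst₂ ℤ._≤_ (cong (λ x → + 1 ℤ.+ x) (count-cast r′ m)) (ℤₚ.pos-* (suc m) q)
      (ℤ.+≤+ (count₆₈ (shorter-cycles {E = Adj q s a S} girth 6) (shorter-cycles {E = Adj q s a S} girth 8))))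

theorem6 : (q : ℕ) → Prime q → q % 2 ≡ 1 → .{{_ : NonZero q}} →
           (r : ℕ) → 2 ≤ r →
           (s : ℕ) → s % q ≢ 0 →
           (a : Fin r → Fin q) → Injective _≡_ _≡_ a →
           (S : Subset q) →
           (HasGirth (Adj q s a S) 8 → ∣ S ∣ * (r ∸ 1) ≤ (r ∸ 1) + (q ∸ 1))
           × (HasGirth (Adj q s a S) 10 →
              LeRootBound ∣ S ∣
                (+ q ℤ.+ + r ℤ.* (+ (2 * r) ℤ.- + 3))
                ((+ q ℤ.+ + r ℤ.* (+ (2 * r) ℤ.- + 3)) ℤ.* (+ q ℤ.+ + r ℤ.* (+ (2 * r) ℤ.- + 3))
                  ℤ.- + 4 ℤ.* + r ℤ.* ((+ r ℤ.- + 1) ℤ.* (+ r ℤ.- + 1) ℤ.* (+ r ℤ.- + 1)))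
                (+ 2 ℤ.* + r ℤ.* (+ r ℤ.- + 1)))
theorem6 q q-prime _ (suc r′) _ s s≢0 a a-injective S =
  girthBounds q q-prime s s≢0 a a-injective S (enumerate S) (enumerate-injective S) (enumerate-∈ S)
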